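{- Let $n\ge 7$ and let $G$ be an $n$-vertex graph containing no subgraph isomorphic to $T$ but containing a subgraph $K$ isomorphic to $K_4$. Then $e(G)\le 2n-2+\mathrm{ex}(n-4,T)$. Moreover, for $n\ge 8$, equality can hold only if every vertex of $G$ not in $K$ is adjacent to exactly $2$ vertices of $K$.
   Context: All graphs are finite, simple and undirected; $e(G)$ is the number of edges. $T$ is the graph on six vertices $a,b,c,d,e,f$ with edges $bc, ce, eb, ab, ac, bd, de, cf, fe$. $\mathrm{ex}(m,T)$ is the maximum number of edges in an $m$-vertex graph not containing $T$ as a subgraph. -}

module Defs where

import Data.Nat
open import Data.Nat using (ℕ; zero; suc; _+_; _<ᵇ_)
open import Data.Bool using (Bool; true; false; _∧_; if_then_else_)
open import Data.Fin using (Fin; toℕ; #_)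
open import Data.List using (List; map; allFin)
open import Data.Nat.ListAction using (sum)
open import Data.Product using (Σ; _×_)
open import Relation.Binary.PropositionalEquality using (_≡_)
open import Relation.Nullary using (¬_)
open import Function.Definitions using (Injective)

record Graph (n : ℕ) : Set where
  field
    adj    : Fin n → Fin n → Bool
    sym    : ∀ i j → adj i j ≡ adj j i
    irrefl : ∀ i → adj i i ≡ false
open Graph public

Adj : ∀ {n} → Graph n → Fin n → Fin n → Set
Adj G i j = adj G i j ≡ true

edges : ∀ {n} → Graph n → ℕ
edges {n} G =
  sum (map (λ i → sum (map (λ j → if (toℕ i <ᵇ toℕ j) ∧ adj G i j then 1 else 0)
                           (allFin n)))
           (allFin n))

-- The graph T on vertices a,b,c,d,e,f = 0,1,2,3,4,5 with edges
-- bc, ce, eb, ab, ac, bd, de, cf, fe.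
record ContainsT {n : ℕ} (G : Graph n) : Set where
  field
    φ   : Fin 6 → Fin n
    inj : Injective _≡_ _≡_ φ
    bc  : Adj G (φ (# 1)) (φ (# 2))
    ce  : Adj G (φ (# 2)) (φ (# 4))
    eb  : Adj G (φ (# 4)) (φ (# 1))
    ab  : Adj G (φ (# 0)) (φ (# 1))
    ac  : Adj G (φ (# 0)) (φ (# 2))
    bd  : Adj G (φ (# 1)) (φ (# 3))
    de  : Adj G (φ (# 3)) (φ (# 4))
    cf  : Adj G (φ (# 2)) (φ (# 5))
    fe  : Adj G (φ (# 5)) (φ (# 4))

TFree : ∀ {n} → Graph n → Set
TFree G = ¬ ContainsT G

IsExT : ℕ → ℕ → Set
IsExT m k = Σ (Graph m) (λ H → TFree H × edges H ≡ k)
          × (∀ (H : Graph m) → TFree H → edges H Data.Nat.≤ k)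

IsK4 : ∀ {n} → Graph n → (Fin 4 → Fin n) → Set
IsK4 G κ = Injective _≡_ _≡_ κ × (∀ i j → ¬ i ≡ j → Adj G (κ i) (κ j))

degInto : ∀ {n} → Graph n → (Fin 4 → Fin n) → Fin n → ℕ
degInto G κ v = sum (map (λ i → if adj G v (κ i) then 1 else 0) (allFin 4))

module Submission where

-- Write m = n − 4, let K be the given K₄ and R = V(G) ∖ K, and let
-- deg_K(x) be the number of neighbours of x in K.  Counting ordered adjacent pairs
-- (handshake lemma) and splitting V(G) into K and R gives
--     e(G) ≤ e(K) + D + e(G[R]) ≤ 6 + D + ex(m,T),   where D = Σ_{x ∈ R} deg_K(x),
-- because G[R] is again T-free.  The heart of the argument is that two distinct
-- vertices u, v ∈ R with deg_K(u) ≥ 2 and deg_K(v) ≥ 3 span a copy of T together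
-- with K: choose a common K-neighbour b of u and v, a further K-neighbour c of u, a
-- further K-neighbour e of v and let f be the last vertex of K; then
-- (a,b,c,d,e,f) = (u,b,c,v,e,f) is a T.  Hence either every x ∈ R has
-- deg_K(x) ≤ 2, or one vertex has deg_K ≤ 4 and all others have deg_K ≤ 1; in
-- both cases D ≤ 2m when m ≥ 3, which is the bound.  If m ≥ 4 the second case
-- gives D < 2m, so equality forces D = 2m with every deg_K(x) ≤ 2, i.e. every
-- deg_K(x) = 2.

open import Defs
open import Data.Nat using (ℕ; zero; suc; _+_; _*_; _∸_; _≤_; _<_; _<ᵇ_; _≤?_; z≤n; s≤s)
open import Data.Nat.Properties
  using ( +-0-commutativeMonoid; module ≤-Reasoning; ≤-refl; ≤-trans; ≤-reflexive; ≤-antisym; ≤-pred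
        ; +-assoc; +-identityʳ; *-identityʳ; +-mono-≤; +-monoˡ-≤; +-monoʳ-≤; +-cancelˡ-≤; +-cancelʳ-≤
        ; *-cancelˡ-≤; m≤m+n; ≮⇒≥; <⇒≱ )
open import Data.Nat.ListAction using () renaming (sum to listSum)
open import Data.Nat.Tactic.RingSolver using (solve-∀)
open import Data.Bool using (Bool; true; false; _∧_; if_then_else_)
open import Data.Fin using (Fin; toℕ; punchIn; punchOut; #_) renaming (zero to fzero; suc to fsuc; _≟_ to _≟ᶠ_)
open import Data.Fin.Properties
  using (toℕ-injective; punchIn-injective; punchInᵢ≢i; punchOut-injective; punchIn-punchOut; any?)
  renaming (suc-injective to fsuc-injective)
open import Data.Vec.Functional using (_∷_)
open import Data.List using (map; allFin; tabulate)
open import Data.List.Properties using (map-tabulate)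
open import Data.Product using (_×_; _,_; proj₁; ∃)
open import Data.Sum using (_⊎_; inj₁; inj₂)
open import Data.Empty using (⊥; ⊥-elim)
open import Function.Base using (_∘_; id)
open import Function.Definitions using (Injective)
open import Relation.Nullary using (¬_; yes; no)
import Relation.Binary.PropositionalEquality as ≡
open ≡ using (_≡_; refl; cong; cong₂; trans)
open import Algebra.Properties.CommutativeMonoid.Sum +-0-commutativeMonoid
  using (sum-remove; ∑-distrib-+; ∑-comm; sum-cong-≗) renaming (sum to ∑)

listSum-allFin : ∀ n (f : Fin n → ℕ) → listSum (map f (allFin n)) ≡ ∑ f
listSum-allFin n f = trans (cong listSum (map-tabulate id f)) (listSum-tabulate n f)
  where
  listSum-tabulate : ∀ n (f : Fin n → ℕ) → listSum (tabulate f) ≡ ∑ f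
  listSum-tabulate zero    f = refl
  listSum-tabulate (suc n) f = cong (f fzero +_) (listSum-tabulate n (f ∘ fsuc))

∑-mono-≤ : ∀ {n} {f g : Fin n → ℕ} → (∀ x → f x ≤ g x) → ∑ f ≤ ∑ g
∑-mono-≤ {zero}  f≤g = z≤n
∑-mono-≤ {suc n} f≤g = +-mono-≤ (f≤g fzero) (∑-mono-≤ (f≤g ∘ fsuc))

∑-bounded : ∀ {n} {f : Fin n → ℕ} c → (∀ x → f x ≤ c) → ∑ f ≤ n * c
∑-bounded {zero}  c f≤c = z≤n
∑-bounded {suc n} c f≤c = +-mono-≤ (f≤c fzero) (∑-bounded c (f≤c ∘ fsuc))

∑-except : ∀ {n} {f : Fin n → ℕ} x {c d} → f x ≤ c → (∀ y → ¬ y ≡ x → f y ≤ d) →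
           ∑ f ≤ c + (n ∸ 1) * d
∑-except {suc n} {f} x {c} {d} fx≤c others≤d = begin
  ∑ f                       ≡⟨ sum-remove {i = x} f ⟩
  f x + ∑ (f ∘ punchIn x)   ≤⟨ +-mono-≤ fx≤c (∑-bounded d (λ y → others≤d (punchIn x y) (punchInᵢ≢i x y))) ⟩
  c + n * d                 ∎
  where open ≤-Reasoning

∑-tight : ∀ {n} {f : Fin n → ℕ} c → (∀ x → f x ≤ c) → n * c ≤ ∑ f → ∀ x → f x ≡ c
∑-tight {suc n} {f} c f≤c n*c≤∑f x = ≤-antisym (f≤c x) c≤fx
  where
  c≤fx : c ≤ f x
  c≤fx = +-cancelʳ-≤ (n * c) c (f x) (begin
    c + n * c                 ≤⟨ n*c≤∑f ⟩
    ∑ f                       ≡⟨ sum-remove {i = x} f ⟩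
    f x + ∑ (f ∘ punchIn x)   ≤⟨ +-monoʳ-≤ (f x) (∑-bounded c (f≤c ∘ punchIn x)) ⟩
    f x + n * c               ∎)
    where open ≤-Reasoning

𝟙 : Bool → ℕ
𝟙 b = if b then 1 else 0

𝟙≤1 : ∀ b → 𝟙 b ≤ 1
𝟙≤1 true  = s≤s z≤n
𝟙≤1 false = z≤n

count : ∀ {n} → (Fin n → Bool) → ℕ
count P = ∑ (𝟙 ∘ P)

count≤ : ∀ {n} (P : Fin n → Bool) → count P ≤ n
count≤ {n} P = ≤-trans (∑-bounded 1 (𝟙≤1 ∘ P)) (≤-reflexive (*-identityʳ n))

count-delete : ∀ {n k} (P : Fin (suc n) → Bool) i → suc k ≤ count P → k ≤ count (P ∘ punchIn i)
count-delete P i k<count = ≤-pred (begin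
  _                                 ≤⟨ k<count ⟩
  count P                           ≡⟨ sum-remove {i = i} (𝟙 ∘ P) ⟩
  𝟙 (P i) + count (P ∘ punchIn i)   ≤⟨ +-monoˡ-≤ _ (𝟙≤1 (P i)) ⟩
  suc (count (P ∘ punchIn i))       ∎)
  where open ≤-Reasoning

witness : ∀ {n} (P : Fin n → Bool) → 1 ≤ count P → ∃ λ i → P i ≡ true
witness {suc n} P 1≤count with P fzero in P0
... | true  = fzero , P0
... | false = let (i , Pi) = witness (P ∘ fsuc) 1≤count in fsuc i , Pi

-- Pigeonhole: two predicates on n positions with more than n hits in total
-- hold simultaneously somewhere, since 𝟙 a + 𝟙 b ≤ 1 + 𝟙 (a ∧ b).
common-witness : ∀ {n} (P Q : Fin n → Bool) → n + 1 ≤ count P + count Q →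
                 ∃ λ i → P i ≡ true × Q i ≡ true
common-witness {n} P Q n<P+Q = let (i , PQi) = witness (λ i → P i ∧ Q i) 1≤count in i , ∧-true PQi
  where
  𝟙-∧ : ∀ a b → 𝟙 a + 𝟙 b ≤ 1 + 𝟙 (a ∧ b)
  𝟙-∧ true  true  = ≤-refl
  𝟙-∧ true  false = ≤-refl
  𝟙-∧ false true  = s≤s z≤n
  𝟙-∧ false false = z≤n
  ∧-true : ∀ {a b} → a ∧ b ≡ true → a ≡ true × b ≡ true
  ∧-true {true} {true} refl = refl , refl
  ∑-ones : ∀ n → ∑ {n} (λ _ → 1) ≡ n
  ∑-ones zero    = refl
  ∑-ones (suc n) = cong suc (∑-ones n)
  1≤count : 1 ≤ count (λ i → P i ∧ Q i)
  1≤count = +-cancelˡ-≤ n 1 _ (begin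
    n + 1                                   ≤⟨ n<P+Q ⟩
    count P + count Q                       ≡⟨ ∑-distrib-+ (𝟙 ∘ P) (𝟙 ∘ Q) ⟨
    ∑ (λ i → 𝟙 (P i) + 𝟙 (Q i))             ≤⟨ ∑-mono-≤ (λ i → 𝟙-∧ (P i) (Q i)) ⟩
    ∑ (λ i → 1 + 𝟙 (P i ∧ Q i))             ≡⟨ ∑-distrib-+ {n} (λ _ → 1) (λ i → 𝟙 (P i ∧ Q i)) ⟩
    ∑ {n} (λ _ → 1) + count (λ i → P i ∧ Q i) ≡⟨ cong (_+ count (λ i → P i ∧ Q i)) (∑-ones n) ⟩
    n + count (λ i → P i ∧ Q i)             ∎)
    where open ≤-Reasoning

∷-injective : ∀ {n} {A : Set} {x : A} {f : Fin n → A} → (∀ i → ¬ f i ≡ x) →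
              Injective _≡_ _≡_ f → Injective _≡_ _≡_ (x ∷ f)
∷-injective fresh f-inj {fzero}  {fzero}  _ = refl
∷-injective fresh f-inj {fzero}  {fsuc j} e = ⊥-elim (fresh j (≡.sym e))
∷-injective fresh f-inj {fsuc i} {fzero}  e = ⊥-elim (fresh i e)
∷-injective fresh f-inj {fsuc i} {fsuc j} e = cong fsuc (f-inj e)

-- x ◂ g sends 0 to x and continues with g inside the positions other than x;
-- iterating it lists a finite set by greedy choices.
infixr 5 _◂_
_◂_ : ∀ {m n} → Fin (suc n) → (Fin m → Fin n) → Fin (suc m) → Fin (suc n)
x ◂ g = x ∷ (punchIn x ∘ g)

◂-injective : ∀ {m n} (x : Fin (suc n)) {g : Fin m → Fin n} → Injective _≡_ _≡_ g →
              Injective _≡_ _≡_ (x ◂ g)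
◂-injective x {g} g-inj =
  ∷-injective (λ y → punchInᵢ≢i x (g y)) (λ e → g-inj (punchIn-injective x _ _ e))

Adj-sym : ∀ {n} (G : Graph n) {x y} → Adj G x y → Adj G y x
Adj-sym G {x} {y} xy = trans (Graph.sym G y x) xy

adjacent-distinct : ∀ {n} (G : Graph n) {x y} → Adj G x y → ¬ x ≡ y
adjacent-distinct G {x} xx refl with trans (≡.sym xx) (Graph.irrefl G x)
... | ()

induced : ∀ {m n} → Graph n → (Fin m → Fin n) → Graph m
induced G ι = record
  { adj = λ a b → adj G (ι a) (ι b) ; sym = λ a b → Graph.sym G (ι a) (ι b) ; irrefl = Graph.irrefl G ∘ ι }

induced-TFree : ∀ {m n} (G : Graph n) {ι : Fin m → Fin n} → Injective _≡_ _≡_ ι →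
                TFree G → TFree (induced G ι)
induced-TFree G {ι} ι-inj T-free T = T-free (record
  { φ = ι ∘ φ ; inj = inj ∘ ι-inj
  ; bc = bc ; ce = ce ; eb = eb ; ab = ab ; ac = ac ; bd = bd ; de = de ; cf = cf ; fe = fe })
  where open ContainsT T

IsK4-reorder : ∀ {n} (G : Graph n) {κ : Fin 4 → Fin n} {ρ : Fin 4 → Fin 4} →
               IsK4 G κ → Injective _≡_ _≡_ ρ → IsK4 G (κ ∘ ρ)
IsK4-reorder G (κ-inj , κ-adj) ρ-inj = ρ-inj ∘ κ-inj , λ i j i≢j → κ-adj _ _ (i≢j ∘ ρ-inj)

-- With a K₄ σ and u ≠ v outside it, u ~ σ₀, σ₁ and v ~ σ₀, σ₂, the map
-- (a,b,c,d,e,f) ↦ (u, σ₀, σ₁, v, σ₂, σ₃) is a copy of T.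
T-from-K4 : ∀ {n} (G : Graph n) {σ : Fin 4 → Fin n} → IsK4 G σ →
            ∀ {u v} → ¬ u ≡ v → (∀ i → ¬ σ i ≡ u) → (∀ i → ¬ σ i ≡ v) →
            Adj G u (σ (# 0)) → Adj G u (σ (# 1)) → Adj G v (σ (# 0)) → Adj G v (σ (# 2)) →
            ContainsT G
T-from-K4 G {σ} (σ-inj , σ-adj) {u} {v} u≢v u∉σ v∉σ u0 u1 v0 v2 = record
  { φ = (u ∷ v ∷ σ) ∘ τ
  ; inj = τ-inj ∘ uvσ-inj
  ; bc = σ-adj (# 0) (# 1) (λ ())
  ; ce = σ-adj (# 1) (# 2) (λ ())
  ; eb = σ-adj (# 2) (# 0) (λ ())
  ; ab = u0
  ; ac = u1
  ; bd = Adj-sym G v0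
  ; de = v2
  ; cf = σ-adj (# 1) (# 3) (λ ())
  ; fe = σ-adj (# 3) (# 2) (λ ())
  }
  where
  -- τ gives the positions of a,b,c,d,e,f in the list u ∷ v ∷ σ
  τ τ⁻¹ : Fin 6 → Fin 6
  τ fzero                            = # 0
  τ (fsuc fzero)                     = # 2
  τ (fsuc (fsuc fzero))              = # 3
  τ (fsuc (fsuc (fsuc fzero)))       = # 1
  τ (fsuc (fsuc (fsuc (fsuc x))))    = fsuc (fsuc (fsuc (fsuc x)))
  τ⁻¹ fzero                          = # 0
  τ⁻¹ (fsuc fzero)                   = # 3
  τ⁻¹ (fsuc (fsuc fzero))            = # 1
  τ⁻¹ (fsuc (fsuc (fsuc fzero)))     = # 2
  τ⁻¹ (fsuc (fsuc (fsuc (fsuc x))))  = fsuc (fsuc (fsuc (fsuc x)))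
  τ⁻¹∘τ : ∀ x → τ⁻¹ (τ x) ≡ x
  τ⁻¹∘τ fzero                         = refl
  τ⁻¹∘τ (fsuc fzero)                  = refl
  τ⁻¹∘τ (fsuc (fsuc fzero))           = refl
  τ⁻¹∘τ (fsuc (fsuc (fsuc fzero)))    = refl
  τ⁻¹∘τ (fsuc (fsuc (fsuc (fsuc x)))) = refl
  τ-inj : Injective _≡_ _≡_ τ
  τ-inj {x} {y} e = trans (≡.sym (τ⁻¹∘τ x)) (trans (cong τ⁻¹ e) (τ⁻¹∘τ y))
  uvσ-inj : Injective _≡_ _≡_ (u ∷ v ∷ σ)
  uvσ-inj = ∷-injective u-fresh (∷-injective v∉σ σ-inj)
    where
    u-fresh : ∀ i → ¬ (v ∷ σ) i ≡ u
    u-fresh fzero    = u≢v ∘ ≡.sym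
    u-fresh (fsuc i) = u∉σ i

module K4-Neighbourhood {n} (G : Graph n) {κ : Fin 4 → Fin n} (K : IsK4 G κ) where

  N : Fin n → Fin 4 → Bool
  N x i = adj G x (κ i)

  degK : Fin n → ℕ
  degK x = count (N x)

  -- Greedy choice of the T: a common K-neighbour b of u and v, a further
  -- K-neighbour c of u, a further K-neighbour e of v, and the last vertex of K.
  no-T-pair : TFree G → ∀ {u v} → ¬ u ≡ v → (∀ i → ¬ κ i ≡ u) → (∀ i → ¬ κ i ≡ v) →
              2 ≤ degK u → 3 ≤ degK v → ⊥
  no-T-pair T-free {u} {v} u≢v u∉K v∉K 2≤u 3≤v
    with common-witness (N u) (N v) (+-mono-≤ 2≤u 3≤v)
  ... | b , ub , vb
    with witness (N u ∘ punchIn b) (count-delete (N u) b 2≤u)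
  ... | c , uc
    with witness (N v ∘ punchIn b ∘ punchIn c) (count-delete (N v ∘ punchIn b) c (count-delete (N v) b 3≤v))
  ... | e , ve
    = T-free (T-from-K4 G (IsK4-reorder G K ρ-inj) u≢v (u∉K ∘ ρ) (v∉K ∘ ρ) ub uc vb ve)
    where
    ρ : Fin 4 → Fin 4
    ρ = b ◂ c ◂ e ◂ id
    ρ-inj : Injective _≡_ _≡_ ρ
    ρ-inj = ◂-injective b (◂-injective c (◂-injective e id))

degree-sum : ∀ {n} → Graph n → ℕ
degree-sum G = ∑ (λ x → ∑ (λ y → 𝟙 (adj G x y)))

<ᵇ-dichotomy : ∀ a b → ¬ a ≡ b → 𝟙 (a <ᵇ b) + 𝟙 (b <ᵇ a) ≡ 1
<ᵇ-dichotomy zero    zero    a≢b = ⊥-elim (a≢b refl)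
<ᵇ-dichotomy zero    (suc b) _   = refl
<ᵇ-dichotomy (suc a) zero    _   = refl
<ᵇ-dichotomy (suc a) (suc b) a≢b = <ᵇ-dichotomy a b (a≢b ∘ cong suc)

𝟙-split : ∀ a p q → (a ≡ true → 𝟙 p + 𝟙 q ≡ 1) → 𝟙 a ≡ 𝟙 (p ∧ a) + 𝟙 (q ∧ a)
𝟙-split true  true  true  one = ≡.sym (one refl)
𝟙-split true  true  false one = refl
𝟙-split true  false true  one = refl
𝟙-split true  false false one = ≡.sym (one refl)
𝟙-split false true  true  _   = refl
𝟙-split false true  false _   = refl
𝟙-split false false true  _   = refl
𝟙-split false false false _   = refl

-- Handshake lemma: each edge {x, y} is one ordered pair with x < y and one with y < x.
handshake : ∀ {n} (G : Graph n) → degree-sum G ≡ 2 * edges G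
handshake {n} G = begin
  degree-sum G                              ≡⟨ sum-cong-≗ (λ x → sum-cong-≗ (both-orders x)) ⟩
  ∑ (λ x → ∑ (λ y → L x y + L y x))         ≡⟨ sum-cong-≗ (λ x → ∑-distrib-+ (L x) (λ y → L y x)) ⟩
  ∑ (λ x → ∑ (L x) + ∑ (λ y → L y x))       ≡⟨ ∑-distrib-+ (λ x → ∑ (L x)) (λ x → ∑ (λ y → L y x)) ⟩
  E + ∑ (λ x → ∑ (λ y → L y x))             ≡⟨ cong (E +_) (∑-comm (λ x y → L y x)) ⟩
  E + E                                     ≡⟨ cong (E +_) (+-identityʳ E) ⟨
  2 * E                                     ≡⟨ cong (2 *_) edges≡E ⟨
  2 * edges G                               ∎
  where
  open ≡.≡-Reasoning
  L : Fin n → Fin n → ℕ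
  L x y = 𝟙 ((toℕ x <ᵇ toℕ y) ∧ adj G x y)
  E : ℕ
  E = ∑ (λ x → ∑ (L x))
  edges≡E : edges G ≡ E
  edges≡E = trans (listSum-allFin n _) (sum-cong-≗ (λ x → listSum-allFin n (L x)))
  both-orders : ∀ x y → 𝟙 (adj G x y) ≡ L x y + L y x
  both-orders x y = trans (𝟙-split (adj G x y) (toℕ x <ᵇ toℕ y) (toℕ y <ᵇ toℕ x) one-order)
                          (cong (λ b → L x y + 𝟙 ((toℕ y <ᵇ toℕ x) ∧ b)) (Graph.sym G x y))
    where
    one-order : Adj G x y → 𝟙 (toℕ x <ᵇ toℕ y) + 𝟙 (toℕ y <ᵇ toℕ x) ≡ 1
    one-order xy = <ᵇ-dichotomy (toℕ x) (toℕ y) (adjacent-distinct G xy ∘ toℕ-injective)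

degree-sum-bound : ∀ {n} (G : Graph (suc n)) → degree-sum G ≤ suc n * n
degree-sum-bound {n} G = ∑-bounded n degree≤n
  where
  degree≤n : ∀ x → ∑ (λ y → 𝟙 (adj G x y)) ≤ n
  degree≤n x = begin
    ∑ (λ y → 𝟙 (adj G x y))                               ≡⟨ sum-remove {i = x} (𝟙 ∘ adj G x) ⟩
    𝟙 (adj G x x) + ∑ (λ y → 𝟙 (adj G x (punchIn x y)))   ≡⟨ cong (λ b → 𝟙 b + ∑ {n} (λ y → 𝟙 (adj G x (punchIn x y)))) (Graph.irrefl G x) ⟩
    ∑ {n} (λ y → 𝟙 (adj G x (punchIn x y)))               ≤⟨ ∑-bounded 1 (λ y → 𝟙≤1 (adj G x (punchIn x y))) ⟩
    n * 1                                                 ≡⟨ *-identityʳ n ⟩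
    n                                                     ∎
    where open ≤-Reasoning

record Complement {k m : ℕ} (κ : Fin k → Fin (k + m)) : Set where
  field
    ι           : Fin m → Fin (k + m)
    ι-injective : Injective _≡_ _≡_ ι
    disjoint    : ∀ i b → ¬ κ i ≡ ι b
    covers      : ∀ x → (∀ i → ¬ κ i ≡ x) → ∃ λ b → ι b ≡ x
    split       : ∀ f → ∑ f ≡ ∑ (f ∘ κ) + ∑ (f ∘ ι)

complement : ∀ k {m} (κ : Fin k → Fin (k + m)) → Injective _≡_ _≡_ κ → Complement κ
complement zero    κ _     = record
  { ι = id ; ι-injective = id ; disjoint = λ () ; covers = λ x _ → x , refl ; split = λ _ → refl }
complement (suc k) κ κ-inj = record
  { ι = ι ; ι-injective = C.ι-injective ∘ punchIn-injective v _ _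
  ; disjoint = disjoint ; covers = covers ; split = split }
  where
  v : Fin (suc k + _)
  v = κ fzero
  v≢κ : ∀ j → ¬ v ≡ κ (fsuc j)
  v≢κ j e with κ-inj e
  ... | ()
  κ′ : Fin k → Fin (k + _)
  κ′ j = punchOut (v≢κ j)
  κ′-back : ∀ j → punchIn v (κ′ j) ≡ κ (fsuc j)
  κ′-back j = punchIn-punchOut (v≢κ j)
  module C = Complement (complement k κ′ (λ e → fsuc-injective (κ-inj (punchOut-injective (v≢κ _) (v≢κ _) e))))
  ι : Fin _ → Fin (suc k + _)
  ι = punchIn v ∘ C.ι
  disjoint : ∀ i b → ¬ κ i ≡ ι b
  disjoint fzero    b e = punchInᵢ≢i v (C.ι b) (≡.sym e)
  disjoint (fsuc j) b e = C.disjoint j b (punchIn-injective v _ _ (trans (κ′-back j) e))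
  covers : ∀ x → (∀ i → ¬ κ i ≡ x) → ∃ λ b → ι b ≡ x
  covers x x∉κ with v ≟ᶠ x
  ... | yes v≡x = ⊥-elim (x∉κ fzero v≡x)
  ... | no  v≢x with C.covers (punchOut v≢x) x′∉κ′
    where
    x′∉κ′ : ∀ j → ¬ κ′ j ≡ punchOut v≢x
    x′∉κ′ j e = x∉κ (fsuc j) (trans (≡.sym (κ′-back j)) (trans (cong (punchIn v) e) (punchIn-punchOut v≢x)))
  ... | b , ιb≡x′ = b , trans (cong (punchIn v) ιb≡x′) (punchIn-punchOut v≢x)
  split : ∀ f → ∑ f ≡ ∑ (f ∘ κ) + ∑ (f ∘ ι)
  split f = begin
    ∑ f                                         ≡⟨ sum-remove {i = v} f ⟩
    f v + ∑ (f ∘ punchIn v)                     ≡⟨ cong (f v +_) (C.split (f ∘ punchIn v)) ⟩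
    f v + (∑ (f ∘ punchIn v ∘ κ′) + ∑ (f ∘ ι))  ≡⟨ +-assoc (f v) _ _ ⟨
    f v + ∑ (f ∘ punchIn v ∘ κ′) + ∑ (f ∘ ι)    ≡⟨ cong (λ s → f v + s + ∑ (f ∘ ι)) (sum-cong-≗ (cong f ∘ κ′-back)) ⟩
    ∑ (f ∘ κ) + ∑ (f ∘ ι)                       ∎
    where open ≡.≡-Reasoning

module _ {k m} (G : Graph (k + m)) {κ : Fin k → Fin (k + m)} (C : Complement κ) where
  open Complement C

  cross : ℕ
  cross = ∑ (λ b → ∑ (λ i → 𝟙 (adj G (ι b) (κ i))))

  degree-sum-split : degree-sum G ≡ (degree-sum (induced G κ) + cross) + (cross + degree-sum (induced G ι))
  degree-sum-split = begin
    degree-sum G                                                ≡⟨ split row ⟩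
    ∑ (row ∘ κ) + ∑ (row ∘ ι)                                   ≡⟨ cong₂ _+_ (sum-cong-≗ (split ∘ a ∘ κ)) (sum-cong-≗ (split ∘ a ∘ ι)) ⟩
    ∑ (λ i → ∑ (a (κ i) ∘ κ) + ∑ (a (κ i) ∘ ι)) +
    ∑ (λ b → ∑ (a (ι b) ∘ κ) + ∑ (a (ι b) ∘ ι))                 ≡⟨ cong₂ _+_ (∑-distrib-+ (λ i → ∑ (a (κ i) ∘ κ)) (λ i → ∑ (a (κ i) ∘ ι)))
                                                                             (∑-distrib-+ (λ b → ∑ (a (ι b) ∘ κ)) (λ b → ∑ (a (ι b) ∘ ι))) ⟩
    (degree-sum (induced G κ) + ∑ (λ i → ∑ (a (κ i) ∘ ι))) +
    (cross + degree-sum (induced G ι))                          ≡⟨ cong (λ s → (degree-sum (induced G κ) + s) + (cross + degree-sum (induced G ι))) κ-to-ι ⟩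
    (degree-sum (induced G κ) + cross) + (cross + degree-sum (induced G ι)) ∎
    where
    open ≡.≡-Reasoning
    a : Fin (k + m) → Fin (k + m) → ℕ
    a x y = 𝟙 (adj G x y)
    row : Fin (k + m) → ℕ
    row x = ∑ (a x)
    κ-to-ι : ∑ (λ i → ∑ (a (κ i) ∘ ι)) ≡ cross
    κ-to-ι = trans (∑-comm (λ i b → a (κ i) (ι b)))
                   (sum-cong-≗ λ b → sum-cong-≗ λ i → cong 𝟙 (Graph.sym G (κ i) (ι b)))

-- One vertex seeing all of K and m − 1 vertices seeing at most one: 4 + (m − 1) ≤ 2m.
star≤double : ∀ {m} → 3 ≤ m → 4 + (m ∸ 1) * 1 ≤ m * 2
star≤double {suc (suc (suc r))} (s≤s (s≤s (s≤s z≤n))) = ≤-trans (m≤m+n _ r) (≤-reflexive (eq r))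
  where
  eq : ∀ r → 4 + (2 + r) * 1 + r ≡ (3 + r) * 2
  eq = solve-∀

star<double : ∀ {m} → 4 ≤ m → 4 + (m ∸ 1) * 1 < m * 2
star<double {suc (suc (suc (suc r)))} (s≤s (s≤s (s≤s (s≤s z≤n)))) = ≤-trans (m≤m+n _ r) (≤-reflexive (eq r))
  where
  eq : ∀ r → 5 + (3 + r) * 1 + r ≡ (4 + r) * 2
  eq = solve-∀

double-minus-two : ∀ m → 2 * (4 + m) ∸ 2 ≡ 6 + m * 2
double-minus-two m = cong (2 +_) (eq m)
  where
  eq : ∀ m → m + (4 + (m + 0)) ≡ 4 + m * 2
  eq = solve-∀

module K4-Count {m} (G : Graph (4 + m)) (T-free : TFree G) {κ : Fin 4 → Fin (4 + m)} (K : IsK4 G κ) where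
  open K4-Neighbourhood G K
  C : Complement κ
  C = complement 4 κ (proj₁ K)
  open Complement C

  H : Graph m
  H = induced G ι

  D : ℕ
  D = cross G C

  edges-bound : edges G ≤ 6 + D + edges H
  edges-bound = *-cancelˡ-≤ 2 (begin
    2 * edges G                                           ≡⟨ handshake G ⟨
    degree-sum G                                          ≡⟨ degree-sum-split G C ⟩
    (degree-sum (induced G κ) + D) + (D + degree-sum H)   ≤⟨ +-monoˡ-≤ _ (+-monoˡ-≤ D (degree-sum-bound (induced G κ))) ⟩
    (12 + D) + (D + degree-sum H)                         ≡⟨ cong (λ s → (12 + D) + (D + s)) (handshake H) ⟩
    (12 + D) + (D + 2 * edges H)                          ≡⟨ rearrange D (edges H) ⟩
    2 * (6 + D + edges H)                                 ∎)
    where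
    open ≤-Reasoning
    rearrange : ∀ d e → (12 + d) + (d + 2 * e) ≡ 2 * (6 + d + e)
    rearrange = solve-∀

  -- If one outside vertex sees 3 vertices of K, every other one sees at most 1.
  star-bound : ∀ b₀ → 3 ≤ degK (ι b₀) → D ≤ 4 + (m ∸ 1) * 1
  star-bound b₀ 3≤b₀ = ∑-except b₀ (count≤ (N (ι b₀))) at-most-one
    where
    at-most-one : ∀ b → ¬ b ≡ b₀ → degK (ι b) ≤ 1
    at-most-one b b≢b₀ = ≮⇒≥ λ 1<b →
      no-T-pair T-free (b≢b₀ ∘ ι-injective) (λ i → disjoint i b) (λ i → disjoint i b₀) 1<b 3≤b₀

  degree-dichotomy : (D ≤ 4 + (m ∸ 1) * 1) ⊎ (∀ b → degK (ι b) ≤ 2)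
  degree-dichotomy with any? (λ b → 3 ≤? degK (ι b))
  ... | yes (b₀ , 3≤b₀) = inj₁ (star-bound b₀ 3≤b₀)
  ... | no  none        = inj₂ λ b → ≮⇒≥ λ 2<b → none (b , 2<b)

  cross-bound : 3 ≤ m → D ≤ m * 2
  cross-bound 3≤m with degree-dichotomy
  ... | inj₁ star  = ≤-trans star (star≤double 3≤m)
  ... | inj₂ all≤2 = ∑-bounded 2 all≤2

  cross-tight : 4 ≤ m → m * 2 ≤ D → ∀ b → degK (ι b) ≡ 2
  cross-tight 4≤m m*2≤D with degree-dichotomy
  ... | inj₁ star  = ⊥-elim (<⇒≱ (star<double 4≤m) (≤-trans m*2≤D star))
  ... | inj₂ all≤2 = ∑-tight 2 all≤2 m*2≤D

lemma2 : (n : ℕ) → 7 ≤ n → (G : Graph n) → TFree G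
         → (κ : Fin 4 → Fin n) → IsK4 G κ
         → (k : ℕ) → IsExT (n ∸ 4) k
         → (edges G ≤ 2 * n ∸ 2 + k)
           × (8 ≤ n → edges G ≡ 2 * n ∸ 2 + k
              → (v : Fin n) → (∀ i → ¬ κ i ≡ v) → degInto G κ v ≡ 2)
lemma2 (suc (suc (suc (suc m)))) (s≤s (s≤s (s≤s (s≤s 3≤m)))) G T-free κ K k (_ , ex-bound) =
  edge-bound , equality-case
  where
  open K4-Count G T-free K
  open Complement C using (ι; ι-injective; covers)
  upper : edges G ≤ 6 + D + k
  upper = ≤-trans edges-bound (+-monoʳ-≤ (6 + D) (ex-bound H (induced-TFree G ι-injective T-free)))
  edge-bound : edges G ≤ 2 * (4 + m) ∸ 2 + k
  edge-bound = begin
    edges G              ≤⟨ upper ⟩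
    6 + D + k            ≤⟨ +-monoˡ-≤ k (+-monoʳ-≤ 6 (cross-bound 3≤m)) ⟩
    6 + m * 2 + k        ≡⟨ cong (_+ k) (double-minus-two m) ⟨
    2 * (4 + m) ∸ 2 + k  ∎
    where open ≤-Reasoning
  equality-case : 8 ≤ 4 + m → edges G ≡ 2 * (4 + m) ∸ 2 + k →
                  ∀ v → (∀ i → ¬ κ i ≡ v) → degInto G κ v ≡ 2
  equality-case (s≤s (s≤s (s≤s (s≤s 4≤m)))) extremal v v∉K with covers v v∉K
  ... | b , refl = trans (listSum-allFin 4 (λ i → 𝟙 (adj G (ι b) (κ i)))) (cross-tight 4≤m m*2≤D b)
    where
    m*2≤D : m * 2 ≤ D
    m*2≤D = +-cancelˡ-≤ 6 _ _ (+-cancelʳ-≤ k _ _ (begin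
      6 + m * 2 + k        ≡⟨ cong (_+ k) (double-minus-two m) ⟨
      2 * (4 + m) ∸ 2 + k  ≡⟨ extremal ⟨
      edges G              ≤⟨ upper ⟩
      6 + D + k            ∎))
      where open ≤-Reasoning
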